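{- Let $(\mathscr{L},\vdash)$ be a logical structure. Then the following statements are equivalent. (1) $(\mathscr{L},\vdash)$ is of Lindenbaum-IV-type. (2) For all $\Gamma\cup\{\alpha\}\subseteq\mathscr{L}$, if $\Gamma\nvdash\alpha$ then there exists a maximal $\alpha$-saturated set $\Sigma\supseteq\Gamma$ (i.e. $\Sigma$ is $\alpha$-saturated and no proper superset of $\Sigma$ is $\alpha$-saturated). (3) For all $\Gamma\cup\{\alpha\}\subseteq\mathscr{L}$, the set $\mathsf{Lim}_\mathscr{L}(\Gamma,\alpha):=\{\Sigma\subseteq\mathscr{L}:\Gamma\subseteq\Sigma\text{ and }\Sigma\nvdash\alpha\}$ has a maximal element with respect to inclusion whenever it is nonempty.
   Context: A logical structure is a pair $(\mathscr{L},\vdash)$ with $\mathscr{L}$ a nonempty set and $\vdash\subseteq\mathcal{P}(\mathscr{L})\times\mathscr{L}$ nonempty; write $\Gamma\vdash\alpha$ for $(\Gamma,\alpha)\in\vdash$. For $\Gamma\cup\{\alpha\}\subseteq\mathscr{L}$: $\Gamma$ is $\alpha$-saturated if $\Gamma\nvdash\alpha$ but $\Gamma\cup\{\beta\}\vdash\alpha$ for every $\beta\in\mathscr{L}\setminus\Gamma$; $\Gamma$ is relatively maximal in $\alpha$ if $\Gamma\nvdash\alpha$ but $\Sigma\vdash\alpha$ for every $\Sigma\supsetneq\Gamma$. $(\mathscr{L},\vdash)$ is of Lindenbaum-IV-type if for all $\Gamma\cup\{\alpha\}\subseteq\mathscr{L}$ with $\Gamma\nvdash\alpha$ there exists $\Sigma\supseteq\Gamma$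 which is relatively maximal in $\alpha$. -}

module Defs where

open import Level using (Level; _⊔_; suc)
open import Data.Product using (Σ; ∃; _×_; _,_)
open import Data.Sum using (_⊎_)
open import Relation.Nullary using (¬_)
open import Relation.Unary using (Pred; _∈_; _∉_; _⊆_)
open import Relation.Binary.PropositionalEquality using (_≡_)

-- Since ⊢ is a relation on *sets*, it must not
-- distinguish subsets with the same elements (field ⊢-resp).
record LogicalStructure (ℓ r : Level) : Set (suc (ℓ ⊔ r)) where
  field
    L      : Set ℓ
    _⊢_    : Pred L ℓ → L → Set r
    L-nonempty : L
    ⊢-nonempty : Σ (Pred L ℓ) λ Γ → Σ L λ α → Γ ⊢ α
    ⊢-resp : ∀ {Γ Δ : Pred L ℓ} {α : L} → Γ ⊆ Δ → Δ ⊆ Γ → Γ ⊢ α → Δ ⊢ α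

module _ {ℓ r : Level} (S : LogicalStructure ℓ r) where
  open LogicalStructure S

  _⊬_ : Pred L ℓ → L → Set r
  Γ ⊬ α = ¬ (Γ ⊢ α)

  _∪｛_｝ : Pred L ℓ → L → Pred L ℓ
  (Γ ∪｛ β ｝) x = Γ x ⊎ x ≡ β

  _⊊_ : Pred L ℓ → Pred L ℓ → Set (ℓ)
  Γ ⊊ Δ = (Γ ⊆ Δ) × ∃ λ x → x ∈ Δ × x ∉ Γ

  IsSaturated : Pred L ℓ → L → Set (ℓ ⊔ r)
  IsSaturated Γ α = (Γ ⊬ α) × (∀ (β : L) → β ∉ Γ → (Γ ∪｛ β ｝) ⊢ α)

  RelativelyMaximal : Pred L ℓ → L → Set (suc ℓ ⊔ r)
  RelativelyMaximal Γ α = (Γ ⊬ α) × (∀ (Δ : Pred L ℓ) → Γ ⊊ Δ → Δ ⊢ α)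

  LindenbaumIV : Set (suc ℓ ⊔ r)
  LindenbaumIV = ∀ (Γ : Pred L ℓ) (α : L) → Γ ⊬ α →
    Σ (Pred L ℓ) λ Δ → Γ ⊆ Δ × RelativelyMaximal Δ α

  MaximalSaturated : Pred L ℓ → L → Set (suc ℓ ⊔ r)
  MaximalSaturated Δ α =
    IsSaturated Δ α × ¬ (Σ (Pred L ℓ) λ Δ' → Δ ⊊ Δ' × IsSaturated Δ' α)

  Lim : Pred L ℓ → L → Pred (Pred L ℓ) (ℓ ⊔ r)
  Lim Γ α Δ = Γ ⊆ Δ × Δ ⊬ α

  HasMaximal : Pred (Pred L ℓ) (ℓ ⊔ r) → Set (suc ℓ ⊔ r)
  HasMaximal P = Σ (Pred L ℓ) λ Δ → Δ ∈ P × ¬ (Σ (Pred L ℓ) λ Δ' → Δ' ∈ P × Δ ⊊ Δ')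

  Cond2 : Set (suc ℓ ⊔ r)
  Cond2 = ∀ (Γ : Pred L ℓ) (α : L) → Γ ⊬ α →
    Σ (Pred L ℓ) λ Δ → Γ ⊆ Δ × MaximalSaturated Δ α

  Cond3 : Set (suc ℓ ⊔ r)
  Cond3 = ∀ (Γ : Pred L ℓ) (α : L) →
    (Σ (Pred L ℓ) λ Δ → Δ ∈ Lim Γ α) → HasMaximal (Lim Γ α)

module Submission where

open import Defs
open import Level using (Level)
open import Data.Product using (_×_; _,_; proj₁)
open import Data.Sum using (inj₁; inj₂)
open import Function.Bundles using (_⇔_; mk⇔)
open import Axiom.ExcludedMiddle using (ExcludedMiddle)
open import Relation.Nullary using (¬_)
open import Relation.Nullary.Decidable using (decidable-stable)
open import Relation.Unary using (Pred; _⊆_)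
open import Relation.Binary.PropositionalEquality using (refl)

-- A relatively maximal set is the same thing as a maximal member of Lim, and it is
-- always maximal α-saturated. Conversely, if Δ is maximal α-saturated and Δ ⊊ Δ′ ⊬ α,
-- extending Δ′ by (2) gives an α-saturated proper superset of Δ; so under (2) the
-- maximal α-saturated sets are exactly the relatively maximal ones. Classical logic
-- enters only to conclude Δ′ ⊢ α from the impossibility of Δ′ ⊬ α.

module Maximality {ℓ r : Level} (S : LogicalStructure ℓ r) where
  open LogicalStructure S

  ⊊-⊆-trans : ∀ {Γ Δ Δ′ : Pred L ℓ} → _⊊_ S Γ Δ → Δ ⊆ Δ′ → _⊊_ S Γ Δ′
  ⊊-⊆-trans (Γ⊆Δ , x , x∈Δ , x∉Γ) Δ⊆Δ′ = (λ y → Δ⊆Δ′ (Γ⊆Δ y)) , x , Δ⊆Δ′ x∈Δ , x∉Γ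

  ⊊-∪｛｝ : ∀ {Γ β} → ¬ Γ β → _⊊_ S Γ (_∪｛_｝ S Γ β)
  ⊊-∪｛｝ {β = β} β∉Γ = inj₁ , β , inj₂ refl , β∉Γ

  relativelyMaximal⇒maximalSaturated : ∀ {Δ α} → RelativelyMaximal S Δ α → MaximalSaturated S Δ α
  relativelyMaximal⇒maximalSaturated (Δ⊬α , above⊢α) =
    (Δ⊬α , λ β β∉Δ → above⊢α _ (⊊-∪｛｝ β∉Δ)) ,
    λ (Δ′ , Δ⊊Δ′ , Δ′⊬α , _) → Δ′⊬α (above⊢α Δ′ Δ⊊Δ′)

  relativelyMaximal⇒maximal-Lim : ∀ {Γ Δ α} → Γ ⊆ Δ → RelativelyMaximal S Δ α → HasMaximal S (Lim S Γ α)
  relativelyMaximal⇒maximal-Lim {Δ = Δ} Γ⊆Δ (Δ⊬α , above⊢α) =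
    Δ , (Γ⊆Δ , Δ⊬α) , λ (Δ′ , (_ , Δ′⊬α) , Δ⊊Δ′) → Δ′⊬α (above⊢α Δ′ Δ⊊Δ′)

  module Classical (lem : ∀ {p} → ExcludedMiddle p) where

    ⊢-stable : ∀ {Δ α} → ¬ ¬ (Δ ⊢ α) → Δ ⊢ α
    ⊢-stable = decidable-stable lem

    maximal-Lim⇒relativelyMaximal : ∀ {Γ α} (m : HasMaximal S (Lim S Γ α)) → RelativelyMaximal S (proj₁ m) α
    maximal-Lim⇒relativelyMaximal (Δ , (Γ⊆Δ , Δ⊬α) , noLarger) =
      Δ⊬α , λ Δ′ Δ⊊Δ′ → ⊢-stable λ Δ′⊬α →
        noLarger (Δ′ , ((λ x → proj₁ Δ⊊Δ′ (Γ⊆Δ x)) , Δ′⊬α) , Δ⊊Δ′)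

    maximalSaturated⇒relativelyMaximal : Cond2 S → ∀ {Δ α} → MaximalSaturated S Δ α → RelativelyMaximal S Δ α
    maximalSaturated⇒relativelyMaximal cond2 {α = α} ((Δ⊬α , _) , noLarger) =
      Δ⊬α , λ Δ′ Δ⊊Δ′ → ⊢-stable λ Δ′⊬α →
        let (Δ″ , Δ′⊆Δ″ , Δ″-saturated , _) = cond2 Δ′ α Δ′⊬α
        in noLarger (Δ″ , ⊊-⊆-trans Δ⊊Δ′ Δ′⊆Δ″ , Δ″-saturated)

    lindenbaumIV⇒cond2 : LindenbaumIV S → Cond2 S
    lindenbaumIV⇒cond2 lindenbaum Γ α Γ⊬α =
      let (Δ , Γ⊆Δ , Δ-relMax) = lindenbaum Γ α Γ⊬α
      in Δ , Γ⊆Δ , relativelyMaximal⇒maximalSaturated Δ-relMax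

    cond2⇒lindenbaumIV : Cond2 S → LindenbaumIV S
    cond2⇒lindenbaumIV cond2 Γ α Γ⊬α =
      let (Δ , Γ⊆Δ , Δ-maxSat) = cond2 Γ α Γ⊬α
      in Δ , Γ⊆Δ , maximalSaturated⇒relativelyMaximal cond2 Δ-maxSat

    lindenbaumIV⇒cond3 : LindenbaumIV S → Cond3 S
    lindenbaumIV⇒cond3 lindenbaum Γ α (Δ₀ , Γ⊆Δ₀ , Δ₀⊬α) =
      let (Δ , Δ₀⊆Δ , Δ-relMax) = lindenbaum Δ₀ α Δ₀⊬α
      in relativelyMaximal⇒maximal-Lim (λ x → Δ₀⊆Δ (Γ⊆Δ₀ x)) Δ-relMax

    cond3⇒lindenbaumIV : Cond3 S → LindenbaumIV S
    cond3⇒lindenbaumIV cond3 Γ α Γ⊬α =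
      let m@(Δ , (Γ⊆Δ , _) , _) = cond3 Γ α (Γ , (λ x → x) , Γ⊬α)
      in Δ , Γ⊆Δ , maximal-Lim⇒relativelyMaximal m

mainTheorem2 : (lem : ∀ {p} → ExcludedMiddle p) →
    ∀ {ℓ r : Level} (S : LogicalStructure ℓ r) →
    (LindenbaumIV S ⇔ Cond2 S) × (Cond2 S ⇔ Cond3 S)
mainTheorem2 lem S =
  mk⇔ lindenbaumIV⇒cond2 cond2⇒lindenbaumIV ,
  mk⇔ (λ c2 → lindenbaumIV⇒cond3 (cond2⇒lindenbaumIV c2))
      (λ c3 → lindenbaumIV⇒cond2 (cond3⇒lindenbaumIV c3))
  where open Maximality.Classical S lem
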